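{- Let $n\ge1$ be an integer and $p$ a prime not dividing $n$. For each prime $r$ dividing $n$ let $n_r=r^{e_r}$ be the exact power of $r$ dividing $n$ and $d_r$ the multiplicative order of $p$ modulo $n_r$ (so $n_2$ is the $2$-part of $n$ when $n$ is even, and we set $n_2=1$ if $n$ is odd). Then there exists an integer $i$ with $p^i\equiv-1 \pmod n$ if and only if the following hold: the orders $d_r$ for the odd primes $r$ dividing $n$ are all even and all have the same $2$-part $2^k\ge2$; $p\equiv-1\pmod{n_2}$ if $n_2\ge2$; and $k=1$ if $n_2\ge4$. In these circumstances the congruence $p^i\equiv-1\pmod n$ is satisfied by $i={\rm lcm}\{d_r/2 : r>2 \text{ prime}, r\mid n\}$ if some odd prime divides $n$, and otherwise by $i=1$. -}

module Defs where

open import Data.Nat as ℕ using (ℕ; suc; _≤_)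
open import Data.Nat.Divisibility using (_∣_)
open import Data.Integer as ℤ using (ℤ; ∣_∣)
open import Data.Product using (_×_; ∃)
open import Relation.Binary.PropositionalEquality using (_≡_)
open import Relation.Nullary using (¬_)

infix 4 _≡_[mod_]

_≡_[mod_] : ℤ → ℤ → ℕ → Set
a ≡ b [mod m ] = m ∣ ∣ a ℤ.- b ∣

ExactExp : ℕ → ℕ → ℕ → Set
ExactExp r m e = (r ℕ.^ e ∣ m) × ¬ (r ℕ.^ suc e ∣ m)

ExactPower : ℕ → ℕ → ℕ → Set
ExactPower r m q = ∃ λ e → q ≡ r ℕ.^ e × ExactExp r m e

IsMultOrder : ℕ → ℤ → ℕ → Set
IsMultOrder m a d =
  (1 ≤ d) × (a ℤ.^ d ≡ ℤ.1ℤ [mod m ]) ×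
  (∀ d′ → 1 ≤ d′ → a ℤ.^ d′ ≡ ℤ.1ℤ [mod m ] → d ≤ d′)

IsLCMOf : (ℕ → Set) → ℕ → Set
IsLCMOf P l = (∀ x → P x → x ∣ l) × (∀ m → (∀ x → P x → x ∣ m) → l ∣ m)

-- For an odd prime r with r^e ∥ n, the only square roots of 1 modulo r^e are ±1, so
-- p^i ≡ -1 (mod r^e) holds exactly when d_r ∣ 2i and d_r ∤ i, that is, when i is an odd
-- multiple of d_r / 2.  Modulo 2^e with e ≥ 2, p^i ≡ -1 forces i to be odd (odd squares are
-- 1 mod 4), and then p ≡ -1 because p^i + 1 = (p + 1)(1 - p + p² - … + p^(i-1)) with an odd
-- second factor.  Since p^i ≡ -1 (mod n) is the conjunction of these prime-power conditions,
-- an i exists iff the d_r share their 2-part 2^k and the conditions on n₂ hold; conversely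
-- 2^(k-1) times an odd common multiple of the odd parts of the d_r works, and so does every
-- lcm of the d_r / 2, since it divides that number.
module Submission where

open import Defs

module PrimePowers where

  open import Data.Nat using (ℕ; zero; suc; _*_; _^_; _≤_; _<_; z≤n; s≤s; NonZero; ≢-nonZero⁻¹; _/_)
  open import Data.Nat.Base using (nonTrivial⇒n>1)
  open import Data.Nat.Properties
  open import Data.Nat.Divisibility
  open import Data.Nat.GCD using (gcd; gcd[m,n]∣m; gcd[m,n]∣n; gcd-greatest)
  open import Data.Nat.Coprimality using (Coprime; coprime-divisor)
  open import Data.Nat.Primality
    using (Prime; prime[2]; euclidsLemma; prime⇒nonZero; prime⇒irreducible; prime⇒nonTrivial)
  open import Data.Nat.Primality.Factorisation using (factorise)
  open import Data.Nat.Induction using (<-wellFounded)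
  open import Data.Nat.Tactic.RingSolver using (solve-∀)
  open import Data.List using (_∷_)
  open import Data.List.Relation.Unary.All using (_∷_)
  open import Data.Product using (_×_; _,_; ∃-syntax)
  open import Data.Sum using (_⊎_; inj₁; inj₂)
  open import Function using (_∘_)
  open import Induction.WellFounded using (Acc; acc)
  open import Relation.Binary.Definitions using (tri<; tri≈; tri>)
  open import Relation.Binary.PropositionalEquality
  open import Relation.Nullary using (¬_; yes; no; contradiction)
  open import Relation.Unary using (Decidable)

  prime⇒2≤ : ∀ {r} → Prime r → 2 ≤ r
  prime⇒2≤ {r} pr = nonTrivial⇒n>1 r {{prime⇒nonTrivial pr}}

  prime∤1 : ∀ {r} → Prime r → ¬ r ∣ 1
  prime∤1 pr r∣1 with ∣1⇒≡1 r∣1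
  ... | refl = contradiction pr λ ()

  prime≢2⇒∤2 : ∀ {r} → Prime r → r ≢ 2 → ¬ r ∣ 2
  prime≢2⇒∤2 pr r≢2 r∣2 with prime⇒irreducible prime[2] r∣2
  ... | inj₁ refl = contradiction pr λ ()
  ... | inj₂ r≡2  = r≢2 r≡2

  prime∤⇒coprime : ∀ {r m} → Prime r → ¬ r ∣ m → Coprime m r
  prime∤⇒coprime pr r∤m (i∣m , i∣r) with prime⇒irreducible pr i∣r
  ... | inj₁ i≡1 = i≡1
  ... | inj₂ refl = contradiction i∣m r∤m

  ∃primeFactor : ∀ t → 2 ≤ t → ∃[ r ] (Prime r × r ∣ t)
  ∃primeFactor 1 (s≤s ())
  ∃primeFactor t@(suc (suc _)) _ with factorise t
  ... | record { factors = r ∷ _ ; isFactorisation = t≡product ; factorsPrime = pr ∷ _ } =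
    r , pr , subst (r ∣_) (sym t≡product) (m∣m*n _)

  ^-monoʳ-∣ : ∀ r {a b} → a ≤ b → r ^ a ∣ r ^ b
  ^-monoʳ-∣ r {b = b} z≤n     = 1∣ (r ^ b)
  ^-monoʳ-∣ r         (s≤s h) = *-monoʳ-∣ r (^-monoʳ-∣ r h)

  prime^∣*⇒∣ : ∀ {r t} → Prime r → ¬ r ∣ t → ∀ a m → r ^ a ∣ m * t → r ^ a ∣ m
  prime^∣*⇒∣ pr r∤t zero    m _ = 1∣ m
  prime^∣*⇒∣ {r} {t} pr r∤t (suc a) m r^1+a∣mt
    with euclidsLemma m t pr (m*n∣⇒m∣ r (r ^ a) r^1+a∣mt)
  ... | inj₂ r∣t              = contradiction r∣t r∤t
  ... | inj₁ (divides m′ refl) =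
    subst (_∣ m′ * r) (*-comm (r ^ a) r) (*-monoˡ-∣ r (prime^∣*⇒∣ pr r∤t a m′ r^a∣m′t))
    where
    instance _ = prime⇒nonZero pr
    swap : ∀ x y z → x * y * z ≡ x * z * y
    swap = solve-∀
    r^a∣m′t : r ^ a ∣ m′ * t
    r^a∣m′t = *-cancelʳ-∣ r (subst₂ _∣_ (*-comm r (r ^ a)) (swap m′ r t) r^1+a∣mt)

  prime^∣*⇒∣⊎∣ : ∀ {r m n} e → Prime r → ¬ (r ∣ m × r ∣ n) → r ^ e ∣ m * n →
                 r ^ e ∣ m ⊎ r ^ e ∣ n
  prime^∣*⇒∣⊎∣ {r} {m} {n} e pr ¬both r^e∣mn with r ∣? n
  ... | no r∤n  = inj₁ (prime^∣*⇒∣ pr r∤n e m r^e∣mn)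
  ... | yes r∣n = inj₂ (prime^∣*⇒∣ pr (λ r∣m → ¬both (r∣m , r∣n)) e n
                          (subst (r ^ e ∣_) (*-comm m n) r^e∣mn))

  exactExp-*ʳ : ∀ {r m e} .{{_ : NonZero r}} → ExactExp r m e → ExactExp r (m * r) (suc e)
  exactExp-*ʳ {r} {m} {e} (r^e∣m , r^1+e∤m) =
    subst (_∣ m * r) (*-comm (r ^ e) r) (*-monoˡ-∣ r r^e∣m) ,
    λ h → r^1+e∤m (*-cancelʳ-∣ r (subst (_∣ m * r) (*-comm r (r ^ suc e)) h))

  exactExp : ∀ {r} → Prime r → ∀ m → .{{NonZero m}} → ∃[ e ] ExactExp r m e
  exactExp {r} pr m = go m (<-wellFounded m)
    where
    instance _ = prime⇒nonZero pr
    go : ∀ m → Acc _<_ m → .{{NonZero m}} → ∃[ e ] ExactExp r m e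
    go m _ with r ∣? m
    go m _ | no r∤m = 0 , 1∣ m , r∤m ∘ subst (_∣ m) (*-identityʳ r)
    go .(m′ * r) (acc rec) | yes (divides m′ refl) =
      let instance _ = m*n≢0⇒m≢0 m′
          (e , m′-exp) = go m′ (rec (m<m*n m′ r (prime⇒2≤ pr)))
      in suc e , exactExp-*ʳ {e = e} m′-exp

  exactExp-unique : ∀ {r m e e′} → ExactExp r m e → ExactExp r m e′ → e ≡ e′
  exactExp-unique {r} {e = e} {e′} (r^e∣m , r^1+e∤m) (r^e′∣m , r^1+e′∤m) with <-cmp e e′
  ... | tri< e<e′ _ _ = contradiction (∣-trans (^-monoʳ-∣ r e<e′) r^e′∣m) r^1+e∤m
  ... | tri≈ _ e≡e′ _ = e≡e′
  ... | tri> _ _ e>e′ = contradiction (∣-trans (^-monoʳ-∣ r e>e′) r^e∣m) r^1+e′∤m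

  exactExp⁺ : ∀ {r m e} → r ∣ m → ExactExp r m e → 1 ≤ e
  exactExp⁺ {r} {e = zero}  r∣m (_ , r^1∤m) =
    contradiction (subst (_∣ _) (sym (*-identityʳ r)) r∣m) r^1∤m
  exactExp⁺     {e = suc e} _ _ = s≤s z≤n

  exactExp-suc⇒∣ : ∀ {r m e} → ExactExp r m (suc e) → r ∣ m
  exactExp-suc⇒∣ {r} {e = e} (r^1+e∣m , _) = m*n∣⇒m∣ r (r ^ e) r^1+e∣m

  ∤⇒exactExp≡0 : ∀ {r m e} → ¬ r ∣ m → ExactExp r m e → e ≡ 0
  ∤⇒exactExp≡0 {e = zero}  _   _     = refl
  ∤⇒exactExp≡0 {e = suc e} r∤m m-exp = contradiction (exactExp-suc⇒∣ {e = e} m-exp) r∤m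

  exactExp-∣*∤ : ∀ {r d m e} → Prime r → d ∣ r * m → ¬ d ∣ m → ExactExp r m e →
                 ExactExp r d (suc e)
  exactExp-∣*∤ {r} {d} {m} {e} pr d∣rm d∤m (r^e∣m , r^1+e∤m) with r ∣? d
  ... | no r∤d = contradiction (coprime-divisor (prime∤⇒coprime pr r∤d) d∣rm) d∤m
  ... | yes (divides d′ refl) = exactExp-*ʳ {e = e} (r^e∣d′ , r^1+e∤d′)
    where
    instance _ = prime⇒nonZero pr
    d′∣m : d′ ∣ m
    d′∣m = *-cancelʳ-∣ r (subst (d′ * r ∣_) (*-comm r m) d∣rm)
    t : ℕ
    t = quotient d′∣m
    r∤t : ¬ r ∣ t
    r∤t (divides s t≡s*r) = d∤m (divides s (begin
      m             ≡⟨ m∣n⇒n≡quotient*m d′∣m ⟩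
      t * d′        ≡⟨ cong (_* d′) t≡s*r ⟩
      s * r * d′    ≡⟨ *-assoc s r d′ ⟩
      s * (r * d′)  ≡⟨ cong (s *_) (*-comm r d′) ⟩
      s * (d′ * r)  ∎))
      where open ≡-Reasoning
    r^e∣d′ : r ^ e ∣ d′
    r^e∣d′ = prime^∣*⇒∣ pr r∤t e d′
               (subst (r ^ e ∣_) (trans (m∣n⇒n≡quotient*m d′∣m) (*-comm t d′)) r^e∣m)
    r^1+e∤d′ : ¬ r ^ suc e ∣ d′
    r^1+e∤d′ h = r^1+e∤m (∣-trans h d′∣m)

  exactExp⇒∤/ : ∀ {r m e} .{{_ : NonZero (r ^ e)}} → ExactExp r m e → ¬ r ∣ m / r ^ e
  exactExp⇒∤/ (r^e∣m , r^1+e∤m) h = r^1+e∤m (m∣n/o⇒m*o∣n r^e∣m h)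

  exactExp⇒∣*∧∤ : ∀ {q d e L} .{{_ : NonZero q}} .{{_ : NonZero (q ^ suc e)}} →
                  ExactExp q d (suc e) → d / q ^ suc e ∣ L → ¬ q ∣ L →
                  d ∣ q * (q ^ e * L) × ¬ d ∣ q ^ e * L
  exactExp⇒∣*∧∤ {q} {d} {e} {L} (q^1+e∣d , _) d/q^1+e∣L q∤L =
    subst (d ∣_) (regroup L q (q ^ e)) (m/n∣o⇒m∣o*n q^1+e∣d d/q^1+e∣L) ,
    λ d∣q^eL → q∤L (*-cancelˡ-∣ (q ^ e) {{m^n≢0 q e}}
                      (subst (_∣ q ^ e * L) (*-comm q (q ^ e)) (∣-trans q^1+e∣d d∣q^eL)))
    where
    regroup : ∀ l q t → l * (q * t) ≡ q * (t * l)
    regroup = solve-∀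

  ∣-byPrimePowers : ∀ n X .{{_ : NonZero n}} →
                    (∀ r e → Prime r → r ∣ n → ExactExp r n e → r ^ e ∣ X) → n ∣ X
  ∣-byPrimePowers n X local with gcd[m,n]∣m n X
  ... | divides 0 n≡0 = contradiction n≡0 (≢-nonZero⁻¹ n)
  ... | divides 1 n≡1*g = subst (_∣ X) (sym (trans n≡1*g (*-identityˡ _))) (gcd[m,n]∣n n X)
  ... | divides t@(suc (suc _)) n≡t*g with ∃primeFactor t (s≤s (s≤s z≤n))
  ... | r , pr , r∣t with exactExp pr n
  ... | e , r^e∣n , r^1+e∤n =
    contradiction (subst (r ^ suc e ∣_) (sym n≡t*g) (*-pres-∣ r∣t r^e∣g)) r^1+e∤n
    where
    r∣n : r ∣ n
    r∣n = subst (r ∣_) (sym n≡t*g) (∣m⇒∣m*n (gcd n X) r∣t)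
    r^e∣g : r ^ e ∣ gcd n X
    r^e∣g = gcd-greatest r^e∣n (local r e pr r∣n (r^e∣n , r^1+e∤n))

  ∤-commonMultiple : ∀ {q} → Prime q → {P : ℕ → Set} → Decidable P →
                     (g : ℕ → ℕ) → (∀ r → P r → ¬ q ∣ g r) →
                     ∀ N → ∃[ L ] (¬ q ∣ L × ∀ r → P r → r < N → g r ∣ L)
  ∤-commonMultiple pq P? g q∤g zero = 1 , prime∤1 pq , λ _ _ ()
  ∤-commonMultiple {q} pq {P} P? g q∤g (suc N) with ∤-commonMultiple pq P? g q∤g N | P? N
  ... | L , q∤L , g∣L | no ¬PN = L , q∤L , g∣L′
    where
    g∣L′ : ∀ r → P r → r < suc N → g r ∣ L
    g∣L′ r Pr r<1+N with m<1+n⇒m<n∨m≡n r<1+N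
    ... | inj₁ r<N  = g∣L r Pr r<N
    ... | inj₂ refl = contradiction Pr ¬PN
  ... | L , q∤L , g∣L | yes PN = g N * L , q∤gL , g∣gL
    where
    q∤gL : ¬ q ∣ g N * L
    q∤gL h with euclidsLemma (g N) L pq h
    ... | inj₁ q∣gN = q∤g N PN q∣gN
    ... | inj₂ q∣L  = q∤L q∣L
    g∣gL : ∀ r → P r → r < suc N → g r ∣ g N * L
    g∣gL r Pr r<1+N with m<1+n⇒m<n∨m≡n r<1+N
    ... | inj₁ r<N  = ∣n⇒∣m*n (g N) (g∣L r Pr r<N)
    ... | inj₂ refl = m∣m*n L

module Congruence where

  open import Data.Nat using (ℕ; zero; suc)
  open import Data.Nat.Divisibility using (_∣_; ∣-trans)
  open import Data.Integer using (ℤ; +_; _+_; _-_; -_; _*_; _^_)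
  import Data.Integer.Divisibility.Signed as ℤ
  open import Data.Integer.Tactic.RingSolver using (solve-∀)
  open import Level using (0ℓ)
  open import Relation.Binary.Bundles using (Setoid)
  open import Relation.Binary.Structures using (IsEquivalence)
  open import Relation.Binary.PropositionalEquality using (_≡_; refl)

  infix 4 _≈_⟨mod_⟩

  -- A record copy of _≡_[mod_], so that a and b can be inferred from the type.
  record _≈_⟨mod_⟩ (a b : ℤ) (m : ℕ) : Set where
    constructor mk≈
    field ≈⇒≡[mod] : a ≡ b [mod m ]
  open _≈_⟨mod_⟩ public

  private
    variable
      a b c d : ℤ
      m k : ℕ

  ≈⇒∣ : a ≈ b ⟨mod m ⟩ → + m ℤ.∣ a - b
  ≈⇒∣ (mk≈ h) = ℤ.∣ᵤ⇒∣ h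

  ∣⇒≈ : + m ℤ.∣ a - b → a ≈ b ⟨mod m ⟩
  ∣⇒≈ h = mk≈ (ℤ.∣⇒∣ᵤ h)

  ∣-resp-≡ : ∀ {k x y} → x ≡ y → k ℤ.∣ x → k ℤ.∣ y
  ∣-resp-≡ refl h = h

  ≈-reflexive : a ≡ b → a ≈ b ⟨mod m ⟩
  ≈-reflexive {a = a} {m = m} refl = ∣⇒≈ (ℤ.divides (+ 0) (a-a≡0*m a (+ m)))
    where
    a-a≡0*m : ∀ a m → a - a ≡ + 0 * m
    a-a≡0*m = solve-∀

  ≈-refl : a ≈ a ⟨mod m ⟩
  ≈-refl = ≈-reflexive refl

  ≈-sym : a ≈ b ⟨mod m ⟩ → b ≈ a ⟨mod m ⟩
  ≈-sym {a = a} {b = b} h = ∣⇒≈ (∣-resp-≡ (-[a-b]≡b-a a b) (ℤ.∣m⇒∣-m (≈⇒∣ h)))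
    where
    -[a-b]≡b-a : ∀ a b → - (a - b) ≡ b - a
    -[a-b]≡b-a = solve-∀

  ≈-trans : a ≈ b ⟨mod m ⟩ → b ≈ c ⟨mod m ⟩ → a ≈ c ⟨mod m ⟩
  ≈-trans {a = a} {b = b} {c = c} h₁ h₂ =
    ∣⇒≈ (∣-resp-≡ (telescope a b c) (ℤ.∣m∣n⇒∣m+n (≈⇒∣ h₁) (≈⇒∣ h₂)))
    where
    telescope : ∀ a b c → (a - b) + (b - c) ≡ a - c
    telescope = solve-∀

  ≈-isEquivalence : IsEquivalence (λ a b → a ≈ b ⟨mod m ⟩)
  ≈-isEquivalence = record { refl = ≈-refl ; sym = ≈-sym ; trans = ≈-trans }

  ≈-setoid : ℕ → Setoid 0ℓ 0ℓ
  ≈-setoid m = record { isEquivalence = ≈-isEquivalence {m} }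

  +-cong-≈ : a ≈ b ⟨mod m ⟩ → c ≈ d ⟨mod m ⟩ → a + c ≈ b + d ⟨mod m ⟩
  +-cong-≈ {a = a} {b = b} {c = c} {d = d} h₁ h₂ =
    ∣⇒≈ (∣-resp-≡ (regroup a b c d) (ℤ.∣m∣n⇒∣m+n (≈⇒∣ h₁) (≈⇒∣ h₂)))
    where
    regroup : ∀ a b c d → (a - b) + (c - d) ≡ (a + c) - (b + d)
    regroup = solve-∀

  -‿cong-≈ : a ≈ b ⟨mod m ⟩ → - a ≈ - b ⟨mod m ⟩
  -‿cong-≈ {a = a} {b = b} h = ∣⇒≈ (∣-resp-≡ (regroup a b) (ℤ.∣m⇒∣-m (≈⇒∣ h)))
    where
    regroup : ∀ a b → - (a - b) ≡ - a - - b
    regroup = solve-∀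

  *-cong-≈ : a ≈ b ⟨mod m ⟩ → c ≈ d ⟨mod m ⟩ → a * c ≈ b * d ⟨mod m ⟩
  *-cong-≈ {a = a} {b = b} {c = c} {d = d} h₁ h₂ =
    ∣⇒≈ (∣-resp-≡ (regroup a b c d) (ℤ.∣m∣n⇒∣m+n (ℤ.∣n⇒∣m*n a (≈⇒∣ h₂)) (ℤ.∣m⇒∣m*n d (≈⇒∣ h₁))))
    where
    regroup : ∀ a b c d → a * (c - d) + (a - b) * d ≡ a * c - b * d
    regroup = solve-∀

  ^-cong-≈ : a ≈ b ⟨mod m ⟩ → ∀ i → a ^ i ≈ b ^ i ⟨mod m ⟩
  ^-cong-≈ h zero    = ≈-refl
  ^-cong-≈ h (suc i) = *-cong-≈ h (^-cong-≈ h i)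

  ≈-mod-∣ : m ∣ k → a ≈ b ⟨mod k ⟩ → a ≈ b ⟨mod m ⟩
  ≈-mod-∣ m∣k (mk≈ h) = mk≈ (∣-trans m∣k h)

module MultiplicativeOrder where

  open PrimePowers
  open Congruence
  open import Data.Nat as ℕ using (ℕ; zero; suc; _≤_; z≤n; s≤s)
  open import Data.Nat.Properties as ℕ using (*-comm; <⇒≱)
  open import Data.Nat.DivMod using (_%_; _/_; m≡m%n+[m/n]*n; m%n<n)
  open import Data.Nat.Divisibility as ℕ using (_∣_; divides; m%n≡0⇒n∣m)
  open import Data.Nat.Primality using (Prime)
  open import Data.Integer as ℤ using (ℤ; _+_; _-_; _*_; _^_; 1ℤ; -1ℤ; ∣_∣)
  open import Data.Integer.Properties using (^-*-assoc; ^-zeroˡ; ^-distribˡ-+-*; *-identityʳ; abs-*)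
  import Data.Integer.Divisibility.Signed as ℤ∣
  open import Data.Integer.Tactic.RingSolver using (solve-∀)
  open import Data.Product using (_×_; _,_)
  open import Data.Sum as Sum using (_⊎_; inj₁; inj₂)
  open import Function.Bundles using (_⇔_; mk⇔)
  open import Relation.Binary.PropositionalEquality using (_≡_; _≢_; refl; sym; trans; cong; subst)
  open import Relation.Nullary using (¬_; contradiction)
  import Relation.Binary.Reasoning.Setoid as SetoidReasoning

  private
    variable
      a x : ℤ
      q r d e i : ℕ

  order∣⇒^≈1 : IsMultOrder q a d → d ∣ i → a ^ i ≈ 1ℤ ⟨mod q ⟩
  order∣⇒^≈1 {q = q} {a = a} {d = d} (_ , a^d≡1 , _) (divides s refl) = begin
    a ^ (s ℕ.* d)  ≡⟨ cong (a ^_) (*-comm s d) ⟩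
    a ^ (d ℕ.* s)  ≡⟨ ^-*-assoc a d s ⟨
    (a ^ d) ^ s    ≈⟨ ^-cong-≈ (mk≈ a^d≡1) s ⟩
    1ℤ ^ s         ≡⟨ ^-zeroˡ s ⟩
    1ℤ             ∎
    where open SetoidReasoning (≈-setoid q)

  ^≈1⇒order∣ : IsMultOrder q a d → a ^ i ≈ 1ℤ ⟨mod q ⟩ → d ∣ i
  ^≈1⇒order∣ {q = q} {a = a} {d = d@(suc _)} {i = i} ord@(_ , _ , minimal) a^i≈1
    with i % d in i%d≡ρ
  ... | zero  = m%n≡0⇒n∣m i d i%d≡ρ
  ... | suc ρ = contradiction (minimal (i % d) 1≤i%d (≈⇒≡[mod] a^[i%d]≈1)) (<⇒≱ (m%n<n i d))
    where
    open SetoidReasoning (≈-setoid q)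
    1≤i%d : 1 ≤ i % d
    1≤i%d = subst (1 ≤_) (sym i%d≡ρ) (s≤s z≤n)
    a^[i%d]≈1 : a ^ (i % d) ≈ 1ℤ ⟨mod q ⟩
    a^[i%d]≈1 = begin
      a ^ (i % d)                          ≡⟨ *-identityʳ _ ⟨
      a ^ (i % d) * 1ℤ                     ≈⟨ *-cong-≈ (≈-refl {a = a ^ (i % d)}) (order∣⇒^≈1 ord (divides (i / d) refl)) ⟨
      a ^ (i % d) * a ^ (i / d ℕ.* d)      ≡⟨ ^-distribˡ-+-* a (i % d) (i / d ℕ.* d) ⟨
      a ^ (i % d ℕ.+ i / d ℕ.* d)          ≡⟨ cong (a ^_) (m≡m%n+[m/n]*n i d) ⟨
      a ^ i                                ≈⟨ a^i≈1 ⟩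
      1ℤ                                   ∎

  ^-double : ∀ a i → a ^ (2 ℕ.* i) ≡ a ^ i * a ^ i
  ^-double a i = trans (cong (λ k → a ^ (i ℕ.+ k)) (ℕ.+-identityʳ i)) (^-distribˡ-+-* a i i)

  sq≈1⇒≈±1 : Prime r → r ≢ 2 → x * x ≈ 1ℤ ⟨mod r ℕ.^ e ⟩ →
             x ≈ 1ℤ ⟨mod r ℕ.^ e ⟩ ⊎ x ≈ -1ℤ ⟨mod r ℕ.^ e ⟩
  sq≈1⇒≈±1 {r = r} {x = x} {e = e} pr r≢2 x²≈1 =
    Sum.map mk≈ mk≈ (prime^∣*⇒∣⊎∣ e pr ¬r∣both r^e∣product)
    where
    factor : ∀ x → x * x - 1ℤ ≡ (x - 1ℤ) * (x + 1ℤ)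
    factor = solve-∀
    r^e∣product : r ℕ.^ e ∣ ∣ x - 1ℤ ∣ ℕ.* ∣ x + 1ℤ ∣
    r^e∣product = subst (r ℕ.^ e ∣_) (trans (cong ∣_∣ (factor x)) (abs-* (x - 1ℤ) (x + 1ℤ)))
                    (≈⇒≡[mod] x²≈1)
    difference : ∀ x → (x + 1ℤ) - (x - 1ℤ) ≡ ℤ.+ 2
    difference = solve-∀
    ¬r∣both : ¬ ((r ∣ ∣ x - 1ℤ ∣) × (r ∣ ∣ x + 1ℤ ∣))
    ¬r∣both (r∣x-1 , r∣x+1) = prime≢2⇒∤2 pr r≢2 (ℤ∣.∣⇒∣ᵤ (∣-resp-≡ (difference x)
      (ℤ∣.∣m∣n⇒∣m-n (ℤ∣.∣ᵤ⇒∣ {ℤ.+ r} {x + 1ℤ} r∣x+1) (ℤ∣.∣ᵤ⇒∣ {ℤ.+ r} {x - 1ℤ} r∣x-1))))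

  ^≈-1⇔order∣2*∧∤ : Prime r → r ≢ 2 → 1 ≤ e → IsMultOrder (r ℕ.^ e) a d →
                    a ^ i ≈ -1ℤ ⟨mod r ℕ.^ e ⟩ ⇔ ((d ∣ 2 ℕ.* i) × ¬ (d ∣ i))
  ^≈-1⇔order∣2*∧∤ {r = r} {e = suc e} {a = a} {d = d} {i = i} pr r≢2 _ ord = mk⇔ to from
    where
    to : a ^ i ≈ -1ℤ ⟨mod r ℕ.^ suc e ⟩ → (d ∣ 2 ℕ.* i) × ¬ (d ∣ i)
    to a^i≈-1 = ^≈1⇒order∣ ord (≈-trans (≈-reflexive (^-double a i)) (*-cong-≈ a^i≈-1 a^i≈-1)) ,
                λ d∣i → prime≢2⇒∤2 pr r≢2 (ℕ.∣-trans (ℕ.m∣m*n (r ℕ.^ e))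
                          (≈⇒≡[mod] (≈-trans (≈-sym (order∣⇒^≈1 ord d∣i)) a^i≈-1)))
    from : (d ∣ 2 ℕ.* i) × ¬ (d ∣ i) → a ^ i ≈ -1ℤ ⟨mod r ℕ.^ suc e ⟩
    from (d∣2i , d∤i) with sq≈1⇒≈±1 {e = suc e} pr r≢2
                             (≈-trans (≈-reflexive (sym (^-double a i))) (order∣⇒^≈1 ord d∣2i))
    ... | inj₁ a^i≈1  = contradiction (^≈1⇒order∣ ord a^i≈1) d∤i
    ... | inj₂ a^i≈-1 = a^i≈-1

module PowersOfTwo where

  open PrimePowers
  open Congruence
  open MultiplicativeOrder using (^-double)
  open import Data.Nat as ℕ using (ℕ; zero; suc; _≤_; z≤n; s≤s)
  open import Data.Nat.Properties as ℕ using (*-comm)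
  open import Data.Nat.Divisibility as ℕ using (_∣_; divides; _∣0; ∣-refl; ∣m∣n⇒∣m+n)
  open import Data.Nat.Primality using (prime[2])
  open import Data.Integer as ℤ using (ℤ; +_; _+_; _-_; -_; _*_; _^_; 0ℤ; 1ℤ; -1ℤ; ∣_∣)
  open import Data.Integer.Properties using (*-identityˡ; ^-zeroˡ; abs-*)
  import Data.Integer.Divisibility.Signed as ℤ∣
  open import Data.Integer.Tactic.RingSolver using (solve-∀)
  open import Data.Product using (_×_; _,_)
  open import Function using (_∘_)
  open import Function.Bundles using (_⇔_; mk⇔)
  open import Relation.Binary.PropositionalEquality
    using (_≡_; refl; sym; trans; cong; subst; module ≡-Reasoning)
  open import Relation.Nullary using (¬_; contradiction)
  import Relation.Binary.Reasoning.Setoid as SetoidReasoning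

  private
    variable
      a : ℤ
      e i : ℕ

  -^odd : ∀ a {i} → ¬ 2 ∣ i → (- a) ^ i ≡ - (a ^ i)
  -^odd a {zero}        2∤0 = contradiction (2 ∣0) 2∤0
  -^odd a {suc zero}    _   = lemma a
    where
    lemma : ∀ a → - a * 1ℤ ≡ - (a * 1ℤ)
    lemma = solve-∀
  -^odd a {suc (suc i)} 2∤2+i = begin
    - a * (- a * (- a) ^ i)   ≡⟨ cong (λ t → - a * (- a * t)) (-^odd a (2∤2+i ∘ ∣m∣n⇒∣m+n ∣-refl)) ⟩
    - a * (- a * - (a ^ i))   ≡⟨ lemma a (a ^ i) ⟩
    - (a * (a * a ^ i))       ∎
    where
    open ≡-Reasoning
    lemma : ∀ a t → - a * (- a * - t) ≡ - (a * (a * t))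
    lemma = solve-∀

  ∤2⇒≈-1[mod2] : ∀ m → ¬ 2 ∣ m → + m ≈ -1ℤ ⟨mod 2 ⟩
  ∤2⇒≈-1[mod2] zero          2∤0   = contradiction (2 ∣0) 2∤0
  ∤2⇒≈-1[mod2] (suc zero)    _     = mk≈ ∣-refl
  ∤2⇒≈-1[mod2] (suc (suc m)) 2∤2+m =
    mk≈ (∣m∣n⇒∣m+n ∣-refl (≈⇒≡[mod] (∤2⇒≈-1[mod2] m (2∤2+m ∘ ∣m∣n⇒∣m+n ∣-refl))))

  odd^≈-1 : a ≈ -1ℤ ⟨mod 2 ⟩ → ∀ i → a ^ i ≈ -1ℤ ⟨mod 2 ⟩
  odd^≈-1 a≈-1 zero    = mk≈ ∣-refl
  odd^≈-1 a≈-1 (suc i) = ≈-trans (*-cong-≈ a≈-1 (odd^≈-1 a≈-1 i)) (mk≈ ∣-refl)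

  odd²≈1[mod4] : a ≈ -1ℤ ⟨mod 2 ⟩ → a * a ≈ 1ℤ ⟨mod 4 ⟩
  odd²≈1[mod4] {a} a≈-1 with ≈⇒∣ a≈-1
  ... | ℤ∣.divides q a+1≡2q = ∣⇒≈ (ℤ∣.divides (q * (q - 1ℤ)) (begin
    a * a - 1ℤ                      ≡⟨ factor a ⟩
    (a + 1ℤ) * ((a + 1ℤ) - + 2)     ≡⟨ cong (λ y → y * (y - + 2)) a+1≡2q ⟩
    (q * + 2) * ((q * + 2) - + 2)   ≡⟨ regroup q ⟩
    q * (q - 1ℤ) * + 4              ∎))
    where
    open ≡-Reasoning
    factor : ∀ a → a * a - 1ℤ ≡ (a + 1ℤ) * ((a + 1ℤ) - + 2)
    factor = solve-∀
    regroup : ∀ q → (q * + 2) * ((q * + 2) - + 2) ≡ q * (q - 1ℤ) * + 4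
    regroup = solve-∀

  ^≈-1[mod4]⇒odd : a ≈ -1ℤ ⟨mod 2 ⟩ → a ^ i ≈ -1ℤ ⟨mod 4 ⟩ → ¬ 2 ∣ i
  ^≈-1[mod4]⇒odd {a} a≈-1 a^i≈-1 (divides j refl) =
    contradiction (ℕ.∣⇒≤ (≈⇒≡[mod] 1≈-1)) λ { (s≤s (s≤s ())) }
    where
    open SetoidReasoning (≈-setoid 4)
    1≈-1 : 1ℤ ≈ -1ℤ ⟨mod 4 ⟩
    1≈-1 = begin
      1ℤ              ≈⟨ odd²≈1[mod4] (odd^≈-1 a≈-1 j) ⟨
      a ^ j * a ^ j   ≡⟨ ^-double a j ⟨
      a ^ (2 ℕ.* j)   ≡⟨ cong (a ^_) (*-comm 2 j) ⟩
      a ^ (j ℕ.* 2)   ≈⟨ a^i≈-1 ⟩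
      -1ℤ             ∎

  geometricSum : ℤ → ℕ → ℤ
  geometricSum b zero    = 0ℤ
  geometricSum b (suc i) = 1ℤ + b * geometricSum b i

  geometricSum-telescopes : ∀ b i → (1ℤ - b) * geometricSum b i ≡ 1ℤ - b ^ i
  geometricSum-telescopes b zero    = lemma b
    where
    lemma : ∀ b → (1ℤ - b) * 0ℤ ≡ 1ℤ - 1ℤ
    lemma = solve-∀
  geometricSum-telescopes b (suc i) = begin
    (1ℤ - b) * (1ℤ + b * geometricSum b i)
      ≡⟨ expand b (geometricSum b i) ⟩
    (1ℤ - b) + b * ((1ℤ - b) * geometricSum b i)
      ≡⟨ cong (λ t → (1ℤ - b) + b * t) (geometricSum-telescopes b i) ⟩
    (1ℤ - b) + b * (1ℤ - b ^ i)
      ≡⟨ collapse b (b ^ i) ⟩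
    1ℤ - b * b ^ i
      ∎
    where
    open ≡-Reasoning
    expand : ∀ b s → (1ℤ - b) * (1ℤ + b * s) ≡ (1ℤ - b) + b * ((1ℤ - b) * s)
    expand = solve-∀
    collapse : ∀ b t → (1ℤ - b) + b * (1ℤ - t) ≡ 1ℤ - b * t
    collapse = solve-∀

  geometricSum≈length : ∀ {b m} → b ≈ 1ℤ ⟨mod m ⟩ → ∀ i → geometricSum b i ≈ + i ⟨mod m ⟩
  geometricSum≈length b≈1 zero    = ≈-refl
  geometricSum≈length {b} {m} b≈1 (suc i) = begin
    1ℤ + b * geometricSum b i   ≈⟨ +-cong-≈ (≈-refl {a = 1ℤ}) (*-cong-≈ b≈1 (geometricSum≈length b≈1 i)) ⟩
    1ℤ + 1ℤ * + i               ≡⟨ cong (λ t → 1ℤ + t) (*-identityˡ (+ i)) ⟩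
    + suc i                     ∎
    where open SetoidReasoning (≈-setoid m)

  ^odd≈-1⇒≈-1 : ∀ e → a ≈ -1ℤ ⟨mod 2 ⟩ → ¬ 2 ∣ i → a ^ i ≈ -1ℤ ⟨mod 2 ℕ.^ e ⟩ →
                a ≈ -1ℤ ⟨mod 2 ℕ.^ e ⟩
  ^odd≈-1⇒≈-1 {a} {i} e a≈-1 2∤i a^i≈-1 =
    mk≈ (prime^∣*⇒∣ prime[2] 2∤∣S∣ e ∣ a + 1ℤ ∣ 2^e∣product)
    where
    S : ℤ
    S = geometricSum (- a) i
    factorisation : a ^ i + 1ℤ ≡ (a + 1ℤ) * S
    factorisation = begin
      a ^ i + 1ℤ       ≡⟨ lemma₁ (a ^ i) ⟩
      1ℤ - - (a ^ i)   ≡⟨ cong (λ t → 1ℤ - t) (-^odd a 2∤i) ⟨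
      1ℤ - (- a) ^ i   ≡⟨ geometricSum-telescopes (- a) i ⟨
      (1ℤ - - a) * S   ≡⟨ cong (_* S) (lemma₂ a) ⟩
      (a + 1ℤ) * S     ∎
      where
      open ≡-Reasoning
      lemma₁ : ∀ t → t + 1ℤ ≡ 1ℤ - - t
      lemma₁ = solve-∀
      lemma₂ : ∀ a → 1ℤ - - a ≡ a + 1ℤ
      lemma₂ = solve-∀
    2^e∣product : 2 ℕ.^ e ∣ ∣ a + 1ℤ ∣ ℕ.* ∣ S ∣
    2^e∣product = subst (2 ℕ.^ e ∣_) (trans (cong ∣_∣ factorisation) (abs-* (a + 1ℤ) S))
                    (≈⇒≡[mod] a^i≈-1)
    2∤∣S∣ : ¬ 2 ∣ ∣ S ∣
    2∤∣S∣ 2∣S = 2∤i (ℤ∣.∣⇒∣ᵤ (∣-resp-≡ (lemma S (+ i))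
                     (ℤ∣.∣m∣n⇒∣m-n (ℤ∣.∣ᵤ⇒∣ {+ 2} {S} 2∣S) (≈⇒∣ S≈i))))
      where
      S≈i : S ≈ + i ⟨mod 2 ⟩
      S≈i = geometricSum≈length (-‿cong-≈ a≈-1) i
      lemma : ∀ s t → s - (s - t) ≡ t
      lemma = solve-∀

  TwoPartCondition : ℤ → ℕ → ℕ → Set
  TwoPartCondition a i m = (2 ≤ m → a ≈ -1ℤ ⟨mod m ⟩) × (4 ≤ m → ¬ 2 ∣ i)

  4∣2^[2+e] : ∀ e → 4 ∣ 2 ℕ.^ (2 ℕ.+ e)
  4∣2^[2+e] e = divides (2 ℕ.^ e) (trans (sym (ℕ.*-assoc 2 2 (2 ℕ.^ e))) (*-comm 4 (2 ℕ.^ e)))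

  4≤2^[2+e] : ∀ e → 4 ≤ 2 ℕ.^ (2 ℕ.+ e)
  4≤2^[2+e] e = ℕ.*-monoʳ-≤ 2 (ℕ.*-monoʳ-≤ 2 (ℕ.m^n>0 2 e))

  ^≈-1[mod2^]⇔ : ∀ e → (1 ≤ e → a ≈ -1ℤ ⟨mod 2 ⟩) →
                 a ^ i ≈ -1ℤ ⟨mod 2 ℕ.^ e ⟩ ⇔ TwoPartCondition a i (2 ℕ.^ e)
  ^≈-1[mod2^]⇔ zero _ =
    mk⇔ (λ _ → (λ { (s≤s ()) }) , λ { (s≤s ()) }) (λ _ → mk≈ (ℕ.1∣ _))
  ^≈-1[mod2^]⇔ {i = i} (suc zero) odd =
    mk⇔ (λ _ → (λ _ → odd (s≤s z≤n)) , λ { (s≤s (s≤s ())) }) (λ _ → odd^≈-1 (odd (s≤s z≤n)) i)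
  ^≈-1[mod2^]⇔ {a} {i} (suc (suc e)) odd = mk⇔ to from
    where
    to : a ^ i ≈ -1ℤ ⟨mod 2 ℕ.^ (2 ℕ.+ e) ⟩ → TwoPartCondition a i (2 ℕ.^ (2 ℕ.+ e))
    to a^i≈-1 = (λ _ → ^odd≈-1⇒≈-1 (2 ℕ.+ e) (odd (s≤s z≤n)) 2∤i a^i≈-1) , λ _ → 2∤i
      where
      2∤i : ¬ 2 ∣ i
      2∤i = ^≈-1[mod4]⇒odd (odd (s≤s z≤n)) (≈-mod-∣ (4∣2^[2+e] e) a^i≈-1)
    from : TwoPartCondition a i (2 ℕ.^ (2 ℕ.+ e)) → a ^ i ≈ -1ℤ ⟨mod 2 ℕ.^ (2 ℕ.+ e) ⟩
    from (a≈-1 , 2∤i) = begin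
      a ^ i        ≈⟨ ^-cong-≈ (a≈-1 (ℕ.≤-trans (s≤s (s≤s z≤n)) (4≤2^[2+e] e))) i ⟩
      (- 1ℤ) ^ i   ≡⟨ -^odd 1ℤ (2∤i (4≤2^[2+e] e)) ⟩
      - (1ℤ ^ i)   ≡⟨ cong -_ (^-zeroˡ i) ⟩
      -1ℤ          ∎
      where open SetoidReasoning (≈-setoid (2 ℕ.^ (2 ℕ.+ e)))

open import Data.Nat using (ℕ; _≤_; _/_)
open import Data.Nat.Divisibility using (_∣_)
open import Data.Nat.Primality using (Prime)
open import Data.Integer using (+_; -1ℤ; _^_)
open import Data.Product using (_×_; ∃-syntax; _,_)
open import Function.Bundles using (_⇔_; mk⇔)
open import Relation.Binary.PropositionalEquality using (_≡_; _≢_)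
open import Relation.Nullary using (¬_)

module Proposition
  (n p : ℕ) (1≤n : 1 ≤ n) (p-prime : Prime p) (p∤n : ¬ p ∣ n)
  (e₂ : ℕ) (n-exp₂ : ExactExp 2 n e₂) (d : ℕ → ℕ)
  (order : ∀ r → Prime r → r ∣ n → ∀ q → ExactPower r n q → IsMultOrder q (+ p) (d r))
  where

  open PrimePowers
  open Congruence
  open MultiplicativeOrder using (^≈-1⇔order∣2*∧∤)
  open PowersOfTwo using (TwoPartCondition; ∤2⇒≈-1[mod2]; ^≈-1[mod2^]⇔)
  import Data.Nat as ℕ
  open import Data.Nat using (zero; suc; z≤n; s≤s; NonZero; >-nonZero; _≟_)
  open import Data.Nat.Properties using (*-comm; *-identityˡ; suc-injective; m^n≢0)
  open import Data.Nat.Divisibility using (_∣0; ∣-trans; _∣?_; ∣⇒≤; m/n∣o⇒m∣o*n; m∣n*o⇒m/n∣o)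
  open import Data.Nat.Primality using (prime?; prime[2]; prime⇒irreducible)
  open import Data.Product using (proj₁; proj₂)
  open import Data.Sum using (inj₂)
  open import Function using (_∘_)
  open import Function.Bundles using (Equivalence)
  open import Relation.Binary.PropositionalEquality using (refl; sym; cong; subst)
  open import Relation.Nullary using (yes; no; ¬?; contradiction)
  open import Relation.Nullary.Decidable using (_×-dec_)
  open import Relation.Unary using (Decidable)
  open Equivalence using (to; from)

  instance
    n≢0 : NonZero n
    n≢0 = >-nonZero 1≤n

  n₂ : ℕ
  n₂ = 2 ℕ.^ e₂

  OddPrimeDivisor : ℕ → Set
  OddPrimeDivisor r = Prime r × r ≢ 2 × r ∣ n

  oddPrimeDivisor? : Decidable OddPrimeDivisor
  oddPrimeDivisor? r = prime? r ×-dec ¬? (r ≟ 2) ×-dec r ∣? n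

  -- d ∣ 2i and d ∤ i say that d is even and i is an odd multiple of d / 2.
  OddMultipleOfHalfOrders : ℕ → Set
  OddMultipleOfHalfOrders i = ∀ r → OddPrimeDivisor r → (d r ∣ 2 ℕ.* i) × ¬ (d r ∣ i)

  p≈-1[mod2] : 1 ≤ e₂ → + p ≈ -1ℤ ⟨mod 2 ⟩
  p≈-1[mod2] 1≤e₂ = ∤2⇒≈-1[mod2] p 2∤p
    where
    2∤p : ¬ 2 ∣ p
    2∤p 2∣p with prime⇒irreducible p-prime 2∣p
    ... | inj₂ refl = p∤n (∣-trans (^-monoʳ-∣ 2 1≤e₂) (proj₁ n-exp₂))

  ^≈-1[mod-oddPrimePower]⇔ : ∀ {r} e i → OddPrimeDivisor r → ExactExp r n e →
    (+ p) ^ i ≈ -1ℤ ⟨mod r ℕ.^ e ⟩ ⇔ ((d r ∣ 2 ℕ.* i) × ¬ (d r ∣ i))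
  ^≈-1[mod-oddPrimePower]⇔ {r} e i (r-prime , r≢2 , r∣n) r-exp =
    ^≈-1⇔order∣2*∧∤ {e = e} r-prime r≢2 (exactExp⁺ r∣n r-exp) (order r r-prime r∣n _ (e , refl , r-exp))

  ^≈-1⇔ : ∀ i → (+ p) ^ i ≈ -1ℤ ⟨mod n ⟩ ⇔ (OddMultipleOfHalfOrders i × TwoPartCondition (+ p) i n₂)
  ^≈-1⇔ i = mk⇔ necessary sufficient
    where
    necessary : (+ p) ^ i ≈ -1ℤ ⟨mod n ⟩ → OddMultipleOfHalfOrders i × TwoPartCondition (+ p) i n₂
    necessary h = oddParts , to (^≈-1[mod2^]⇔ e₂ p≈-1[mod2]) (≈-mod-∣ (proj₁ n-exp₂) h)
      where
      oddParts : OddMultipleOfHalfOrders i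
      oddParts r r-odd@(r-prime , _) with exactExp r-prime n
      ... | e , r-exp = to (^≈-1[mod-oddPrimePower]⇔ e i r-odd r-exp) (≈-mod-∣ (proj₁ r-exp) h)
    sufficient : OddMultipleOfHalfOrders i × TwoPartCondition (+ p) i n₂ → (+ p) ^ i ≈ -1ℤ ⟨mod n ⟩
    sufficient (oddParts , twoPart) = mk≈ (∣-byPrimePowers n _ local)
      where
      local : ∀ r e → Prime r → r ∣ n → ExactExp r n e → (+ p) ^ i ≡ -1ℤ [mod r ℕ.^ e ]
      local r e r-prime r∣n r-exp with r ≟ 2
      ... | yes refl = subst (λ k → (+ p) ^ i ≡ -1ℤ [mod 2 ℕ.^ k ])
                             (exactExp-unique {2} {n} {e₂} {e} n-exp₂ r-exp)
                             (≈⇒≡[mod] (from (^≈-1[mod2^]⇔ e₂ p≈-1[mod2]) twoPart))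
      ... | no r≢2   = ≈⇒≡[mod] (from (^≈-1[mod-oddPrimePower]⇔ e i r-odd r-exp) (oddParts r r-odd))
        where
        r-odd : OddPrimeDivisor r
        r-odd = r-prime , r≢2 , r∣n

  Conditions : Set
  Conditions = ∃[ k ] (1 ≤ k
                 × (∀ r → Prime r → r ≢ 2 → r ∣ n → 2 ∣ d r × ExactExp 2 (d r) k)
                 × (2 ≤ n₂ → (+ p) ≡ -1ℤ [mod n₂ ])
                 × (4 ≤ n₂ → k ≡ 1))

  ^≈-1⇒conditions : ∀ i → (+ p) ^ i ≈ -1ℤ ⟨mod n ⟩ → Conditions
  ^≈-1⇒conditions i h with to (^≈-1⇔ i) h
  ^≈-1⇒conditions zero h | oddParts , p≈-1 , _ =
    1 , s≤s z≤n , noOddPrimeDivisor , ≈⇒≡[mod] ∘ p≈-1 , λ _ → refl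
    where
    noOddPrimeDivisor : ∀ r → Prime r → r ≢ 2 → r ∣ n → 2 ∣ d r × ExactExp 2 (d r) 1
    noOddPrimeDivisor r r-prime r≢2 r∣n =
      contradiction (d r ∣0) (proj₂ (oddParts r (r-prime , r≢2 , r∣n)))
  ^≈-1⇒conditions i@(suc _) h | oddParts , p≈-1 , 2∤i with exactExp prime[2] i
  ... | a , i-exp = suc a , s≤s z≤n , halfOrders , ≈⇒≡[mod] ∘ p≈-1 , λ 4≤n₂ → cong suc (a≡0 4≤n₂)
    where
    halfOrders : ∀ r → Prime r → r ≢ 2 → r ∣ n → 2 ∣ d r × ExactExp 2 (d r) (suc a)
    halfOrders r r-prime r≢2 r∣n with oddParts r (r-prime , r≢2 , r∣n)
    ... | d∣2i , d∤i = exactExp-suc⇒∣ {e = a} dr-exp , dr-exp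
      where
      dr-exp : ExactExp 2 (d r) (suc a)
      dr-exp = exactExp-∣*∤ {e = a} prime[2] d∣2i d∤i i-exp
    a≡0 : 4 ≤ n₂ → a ≡ 0
    a≡0 4≤n₂ = ∤⇒exactExp≡0 {e = a} (2∤i 4≤n₂) i-exp

  oddMultiple⇒^≈-1 : Conditions → ∀ i → OddMultipleOfHalfOrders i → (4 ≤ n₂ → ¬ 2 ∣ i) →
                     (+ p) ^ i ≈ -1ℤ ⟨mod n ⟩
  oddMultiple⇒^≈-1 (_ , _ , _ , p≡-1 , _) i oddParts 2∤i =
    from (^≈-1⇔ i) (oddParts , mk≈ ∘ p≡-1 , 2∤i)

  oddMultipleWitness : Conditions → ∃[ C ] (OddMultipleOfHalfOrders C × (4 ≤ n₂ → ¬ 2 ∣ C))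
  oddMultipleWitness (suc k , _ , halfOrders , _ , k≡1) = 2 ℕ.^ k ℕ.* L , oddParts , odd
    where
    instance _ = m^n≢0 2 (suc k)
    oddPart : ℕ → ℕ
    oddPart r = d r / 2 ℕ.^ suc k
    2∤oddPart : ∀ r → OddPrimeDivisor r → ¬ 2 ∣ oddPart r
    2∤oddPart r (r-prime , r≢2 , r∣n) = exactExp⇒∤/ {e = suc k} (proj₂ (halfOrders r r-prime r≢2 r∣n))
    common : ∃[ L ] (¬ 2 ∣ L × ∀ r → OddPrimeDivisor r → r ℕ.< suc n → oddPart r ∣ L)
    common = ∤-commonMultiple prime[2] oddPrimeDivisor? oddPart 2∤oddPart (suc n)
    L : ℕ
    L = proj₁ common
    2∤L : ¬ 2 ∣ L
    2∤L = proj₁ (proj₂ common)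
    oddParts : OddMultipleOfHalfOrders (2 ℕ.^ k ℕ.* L)
    oddParts r r-odd@(r-prime , r≢2 , r∣n) =
      exactExp⇒∣*∧∤ {e = k} (proj₂ (halfOrders r r-prime r≢2 r∣n))
                    (proj₂ (proj₂ common) r r-odd (s≤s (∣⇒≤ r∣n))) 2∤L
    odd : 4 ≤ n₂ → ¬ 2 ∣ 2 ℕ.^ k ℕ.* L
    odd 4≤n₂ = subst (λ j → ¬ 2 ∣ 2 ℕ.^ j ℕ.* L) (sym (suc-injective (k≡1 4≤n₂)))
                     (2∤L ∘ subst (2 ∣_) (*-identityˡ L))

  HalfOrder : ℕ → Set
  HalfOrder x = ∃[ r ] (Prime r × r ≢ 2 × r ∣ n × x ≡ d r / 2)

  lcm⇒oddMultiple : Conditions → ∀ i → IsLCMOf HalfOrder i →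
                    OddMultipleOfHalfOrders i × (4 ≤ n₂ → ¬ 2 ∣ i)
  lcm⇒oddMultiple c@(_ , _ , halfOrders , _ , _) i (half∣i , i-least) with oddMultipleWitness c
  ... | C , C-oddParts , C-odd = oddParts , λ 4≤n₂ 2∣i → C-odd 4≤n₂ (∣-trans 2∣i i∣C)
    where
    2∣d : ∀ r → OddPrimeDivisor r → 2 ∣ d r
    2∣d r (r-prime , r≢2 , r∣n) = proj₁ (halfOrders r r-prime r≢2 r∣n)
    i∣C : i ∣ C
    i∣C = i-least C λ where
      _ (r , r-prime , r≢2 , r∣n , refl) →
        let r-odd = r-prime , r≢2 , r∣n
        in m∣n*o⇒m/n∣o (2∣d r r-odd) (subst (d r ∣_) (*-comm 2 C) (proj₁ (C-oddParts r r-odd)))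
    oddParts : OddMultipleOfHalfOrders i
    oddParts r r-odd@(r-prime , r≢2 , r∣n) =
      subst (d r ∣_) (*-comm i 2) (m/n∣o⇒m∣o*n (2∣d r r-odd) (half∣i _ (r , r-prime , r≢2 , r∣n , refl))) ,
      λ d∣i → proj₂ (C-oddParts r r-odd) (∣-trans d∣i i∣C)

open Congruence using (mk≈; ≈⇒≡[mod])
open PrimePowers using (prime∤1)
open import Data.Nat.Primality using (prime[2])
open import Relation.Binary.PropositionalEquality using (refl)
open import Relation.Nullary using (contradiction)

proposition4p4 :
    (n p : ℕ) → 1 ≤ n → Prime p → ¬ (p ∣ n) →
    (n₂ : ℕ) → ExactPower 2 n n₂ →
    (d : ℕ → ℕ) →
    (∀ r → Prime r → r ∣ n → ∀ q → ExactPower r n q → IsMultOrder q (+ p) (d r)) →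
    let Conds = ∃[ k ] (1 ≤ k
                  × (∀ r → Prime r → r ≢ 2 → r ∣ n → 2 ∣ d r × ExactExp 2 (d r) k)
                  × (2 ≤ n₂ → (+ p) ≡ -1ℤ [mod n₂ ])
                  × (4 ≤ n₂ → k ≡ 1))
    in ((∃[ i ] ((+ p) ^ i ≡ -1ℤ [mod n ])) ⇔ Conds)
       × (Conds →
           ((∃[ r ] (Prime r × r ≢ 2 × r ∣ n)) →
              ∀ i → IsLCMOf (λ x → ∃[ r ] (Prime r × r ≢ 2 × r ∣ n × x ≡ d r / 2)) i →
              (+ p) ^ i ≡ -1ℤ [mod n ])
           × (¬ (∃[ r ] (Prime r × r ≢ 2 × r ∣ n)) → (+ p) ^ 1 ≡ -1ℤ [mod n ]))
proposition4p4 n p 1≤n p-prime p∤n _ (e₂ , refl , n-exp₂) d order =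
  mk⇔ (λ (i , h) → ^≈-1⇒conditions i (mk≈ h))
      (λ c → let C , oddParts , odd = oddMultipleWitness c
             in C , ≈⇒≡[mod] (oddMultiple⇒^≈-1 c C oddParts odd)) ,
  λ c →
    -- The lcm clause does not need an odd prime divisor: the lcm of an empty family is 1.
    (λ _ i lcm → let oddParts , odd = lcm⇒oddMultiple c i lcm
                 in ≈⇒≡[mod] (oddMultiple⇒^≈-1 c i oddParts odd)) ,
    (λ none → ≈⇒≡[mod] (oddMultiple⇒^≈-1 c 1 (λ r r-odd → contradiction (r , r-odd) none)
                                             (λ _ → prime∤1 prime[2])))
  where open Proposition n p 1≤n p-prime p∤n e₂ n-exp₂ d order
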